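{- Let $a\in\mathcal{A}$ and let $t,z$ be standard episturmian sequences with $z=\psi_a(t)$. Let $w$ be a factor of $z$ with $|w|>1$, such that $w$ is not a power of a letter and every conjugate of $w$ is also a factor of $z$. Then there exists a factor $u$ of $t$ such that $w=\psi_a(u)$ or $w=\overline{\psi}_a(u)$.
   Context: $\mathcal{A}$ is a finite alphabet. For $a\in\mathcal{A}$: $\psi_a(a)=\overline{\psi}_a(a)=a$, $\psi_a(x)=ax$, $\overline{\psi}_a(x)=xa$ for letters $x\neq a$, extended to morphisms on finite and infinite words. For a finite word $u$, $u^{(+)}$ is the shortest palindrome having $u$ as a prefix; an infinite word $s$ is a standard episturmian sequence if for every prefix $u$ of $s$, $u^{(+)}$ is a prefix of $s$. Words $w,w'$ are conjugate if $w=xy$, $w'=yx$ for some words $x,y$. -}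

module Defs where

open import Data.Nat using (ℕ; _+_; _<_; _≤_)
open import Data.Fin using (Fin; _≟_)
open import Data.List using (List; []; _∷_; _++_; length; reverse; concatMap; tabulate)
open import Data.List.Relation.Unary.All using (All)
open import Data.Product using (Σ; ∃; _×_; _,_)
open import Relation.Binary.PropositionalEquality using (_≡_)
open import Relation.Nullary using (yes; no)

Letter : ℕ → Set
Letter k = Fin k

Word : ℕ → Set
Word k = List (Letter k)

InfWord : ℕ → Set
InfWord k = ℕ → Letter k

slice : ∀ {k} → InfWord k → ℕ → ℕ → Word k
slice s i n = tabulate {n = n} (λ j → s (i + Data.Fin.toℕ j))

pref : ∀ {k} → InfWord k → ℕ → Word k
pref s n = slice s 0 n

IsPrefix : ∀ {k} → Word k → InfWord k → Set
IsPrefix u s = u ≡ pref s (length u)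

IsFactor : ∀ {k} → Word k → InfWord k → Set
IsFactor w s = ∃ λ i → w ≡ slice s i (length w)

IsPrefixW : ∀ {k} → Word k → Word k → Set
IsPrefixW u v = ∃ λ x → v ≡ u ++ x

IsPalindrome : ∀ {k} → Word k → Set
IsPalindrome p = reverse p ≡ p

IsPalClosure : ∀ {k} → Word k → Word k → Set
IsPalClosure {k} u p =
  IsPalindrome p × IsPrefixW u p ×
  ((q : Word k) → IsPalindrome q → IsPrefixW u q → length p ≤ length q)

StandardEpisturmian : ∀ {k} → InfWord k → Set
StandardEpisturmian {k} s =
  (n : ℕ) (p : Word k) → IsPalClosure (pref s n) p → IsPrefix p s

ψ-letter : ∀ {k} → Letter k → Letter k → Word k
ψ-letter a x with x ≟ a
... | yes _ = a ∷ []
... | no  _ = a ∷ x ∷ []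

ψ̄-letter : ∀ {k} → Letter k → Letter k → Word k
ψ̄-letter a x with x ≟ a
... | yes _ = a ∷ []
... | no  _ = x ∷ a ∷ []

ψ : ∀ {k} → Letter k → Word k → Word k
ψ a = concatMap (ψ-letter a)

ψ̄ : ∀ {k} → Letter k → Word k → Word k
ψ̄ a = concatMap (ψ̄-letter a)

-- z = ψ_a(t) for infinite words: ψ_a extended to infinite words is the
-- unique infinite word having ψ_a(t[0..n)) as a prefix for every n
-- (ψ_a is non-erasing).
IsImageψ : ∀ {k} → Letter k → InfWord k → InfWord k → Set
IsImageψ a t z = (n : ℕ) → IsPrefix (ψ a (pref t n)) z

IsConjugate : ∀ {k} → Word k → Word k → Set
IsConjugate {k} w w' = Σ (Word k) λ x → Σ (Word k) λ y → (w ≡ x ++ y) × (w' ≡ y ++ x)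

IsLetterPower : ∀ {k} → Word k → Set
IsLetterPower {k} w = Σ (Letter k) λ b → All (_≡ b) w

-- (1) Structure of z = ψ_a(t) (module Image): z is the concatenation of the blocks ψ_a(t(n)),
--     each a or a t(n). Hence letters ≠ a are isolated, and a factor of z that begins with a and
--     is followed by a is ψ_a(u) for a factor u of t.
-- (2) Runs of a in a standard episturmian word s = a^P b ⋯ (runGap): every maximal run a^r
--     between letters ≠ a has r ≥ P, and a^(P+2) is not a factor. Both come from one descent on
--     palindromic prefixes (noOccurrence): consecutive palindromic prefixes m < n satisfy
--     n ≤ m + 1 + d whenever s(d) ⋯ s(m) is a palindrome (gapBound, via the palindromic closure
--     of s(0) ⋯ s(m)), so an occurrence of a mirror-closed pattern in a palindromic prefix can be
--     moved into a shorter one unless it straddles the centre, which is excluded case by case.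
-- (3) The theorem is a case analysis on the letters around w (module Decomposition), using the
--     conjugates of w; the case w = a a ⋯ followed by a letter ≠ a contradicts (2), since the
--     final run of a's of w is maximal while a conjugate contains a run longer by two.
module Submission where

open import Defs
open import Data.Nat using (ℕ; zero; suc; _+_; _<_; _≤_; z≤n; s≤s; _≤?_; _<?_)
open import Data.Nat.Properties
open import Data.Nat.Induction using (<-rec)
open import Data.Nat.Tactic.RingSolver using (solve-∀)
open import Data.Fin using (toℕ) renaming (_≟_ to _≟ᴸ_)
open import Data.List using (List; []; _∷_; _++_; _∷ʳ_; length; reverse; take; drop)
open import Data.List.Properties
open import Data.List.Relation.Unary.All using (All; []; _∷_)
open import Data.Product using (Σ; _×_; _,_; proj₁; proj₂; map₁)
open import Data.Sum using (_⊎_; inj₁; inj₂)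
open import Data.Empty using (⊥; ⊥-elim)
open import Relation.Binary.PropositionalEquality hiding ([_])
open import Relation.Nullary using (¬_; Dec; yes; no; ¬?)
open import Relation.Nullary.Decidable using (decidable-stable)
open ≡-Reasoning

module _ {A : Set} where

  seg : (ℕ → A) → ℕ → ℕ → List A
  seg s i zero    = []
  seg s i (suc n) = s i ∷ seg s (suc i) n

  length-seg : ∀ s i n → length (seg s i n) ≡ n
  length-seg s i zero    = refl
  length-seg s i (suc n) = cong suc (length-seg s (suc i) n)

  at-suc : ∀ (s : ℕ → A) i l → s (suc i + l) ≡ s (i + suc l)
  at-suc s i l = cong s (sym (+-suc i l))

  at-zero : ∀ (s : ℕ → A) i → s i ≡ s (i + 0)
  at-zero s i = cong s (sym (+-identityʳ i))

  seg-++ : ∀ s i m n → seg s i (m + n) ≡ seg s i m ++ seg s (i + m) n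
  seg-++ s i zero    n = cong (λ p → seg s p n) (sym (+-identityʳ i))
  seg-++ s i (suc m) n =
    cong (s i ∷_) (trans (seg-++ s (suc i) m n) (cong (λ p → seg s (suc i) m ++ seg s p n) (sym (+-suc i m))))

  seg-∷ʳ : ∀ s i n → seg s i (suc n) ≡ seg s i n ∷ʳ s (i + n)
  seg-∷ʳ s i zero    = cong (_∷ []) (at-zero s i)
  seg-∷ʳ s i (suc n) = cong (s i ∷_) (trans (seg-∷ʳ s (suc i) n) (cong (seg s (suc i) n ∷ʳ_) (at-suc s i n)))

  seg-ext : ∀ s s' i i' n → (∀ l → l < n → s (i + l) ≡ s' (i' + l)) → seg s i n ≡ seg s' i' n
  seg-ext s s' i i' zero    h = refl
  seg-ext s s' i i' (suc n) h =
    cong₂ _∷_ (trans (at-zero s i) (trans (h 0 (s≤s z≤n)) (sym (at-zero s' i'))))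
              (seg-ext s s' (suc i) (suc i') n λ l p →
                 trans (at-suc s i l) (trans (h (suc l) (s≤s p)) (sym (at-suc s' i' l))))

  seg-pointwise : ∀ s s' i i' n → seg s i n ≡ seg s' i' n → ∀ l → l < n → s (i + l) ≡ s' (i' + l)
  seg-pointwise s s' i i' (suc n) e zero    _       =
    trans (sym (at-zero s i)) (trans (∷-injectiveˡ e) (at-zero s' i'))
  seg-pointwise s s' i i' (suc n) e (suc l) (s≤s p) =
    trans (sym (at-suc s i l)) (trans (seg-pointwise s s' (suc i) (suc i') n (∷-injectiveʳ e) l p) (at-suc s' i' l))

  reverse-seg-∷ : ∀ (s : ℕ → A) i L → reverse (seg s i (suc L)) ≡ reverse (seg s (suc i) L) ∷ʳ s i
  reverse-seg-∷ s i L = unfold-reverse (s i) (seg s (suc i) L)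

  Facing : (ℕ → A) → (ℕ → A) → ℕ → ℕ → ℕ → Set
  Facing s s' i i' L = ∀ x y → suc (x + y) ≡ L → s (i + y) ≡ s' (i' + x)

  reverse-seg⇒facing : ∀ s s' i i' L → reverse (seg s i L) ≡ seg s' i' L → Facing s s' i i' L
  reverse-seg⇒facing s s' i i' (suc L) e = facing
    where
      halves : reverse (seg s (suc i) L) ≡ seg s' i' L × s i ≡ s' (i' + L)
      halves = ∷ʳ-injective (reverse (seg s (suc i) L)) (seg s' i' L)
                 (trans (sym (reverse-seg-∷ s i L)) (trans e (seg-∷ʳ s' i' L)))
      facing : Facing s s' i i' (suc L)
      facing x zero    xy = trans (sym (at-zero s i))
                              (trans (proj₂ halves) (cong (λ p → s' (i' + p)) (trans (sym (suc-injective xy)) (+-identityʳ x))))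
      facing x (suc y) xy = trans (sym (at-suc s i y))
                              (reverse-seg⇒facing s s' (suc i) i' L (proj₁ halves) x y (suc-injective (trans (cong suc (sym (+-suc x y))) xy)))

  facing⇒reverse-seg : ∀ s s' i i' L → Facing s s' i i' L → reverse (seg s i L) ≡ seg s' i' L
  facing⇒reverse-seg s s' i i' zero    h = refl
  facing⇒reverse-seg s s' i i' (suc L) h = begin
    reverse (seg s i (suc L))          ≡⟨ reverse-seg-∷ s i L ⟩
    reverse (seg s (suc i) L) ∷ʳ s i   ≡⟨ cong₂ _∷ʳ_ (facing⇒reverse-seg s s' (suc i) i' L inner) outer ⟩
    seg s' i' L ∷ʳ s' (i' + L)          ≡⟨ sym (seg-∷ʳ s' i' L) ⟩
    seg s' i' (suc L)                   ∎
    where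
      inner : Facing s s' (suc i) i' L
      inner x y xy = trans (at-suc s i y) (h x (suc y) (cong suc (trans (+-suc x y) xy)))
      outer : s i ≡ s' (i' + L)
      outer = trans (at-zero s i) (h L 0 (cong suc (+-identityʳ L)))

  Mirror : (ℕ → A) → ℕ → ℕ → Set
  Mirror s i L = ∀ x y → suc (x + y) ≡ L → s (i + x) ≡ s (i + y)

module _ {k : ℕ} where

  palindrome⇒mirror : ∀ (s : InfWord k) i L → IsPalindrome (seg s i L) → Mirror s i L
  palindrome⇒mirror s i L p x y xy = sym (reverse-seg⇒facing s s i i L p x y xy)

  mirror⇒palindrome : ∀ (s : InfWord k) i L → Mirror s i L → IsPalindrome (seg s i L)
  mirror⇒palindrome s i L m = facing⇒reverse-seg s s i i L λ x y xy → sym (m x y xy)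

++-split : ∀ {A : Set} (xs xs' ys ys' : List A) → length xs ≡ length xs' →
           xs ++ ys ≡ xs' ++ ys' → xs ≡ xs' × ys ≡ ys'
++-split []       []        ys ys' _ e = refl , e
++-split (x ∷ xs) (x' ∷ xs') ys ys' l e with ∷-injective e
... | refl , e' = map₁ (cong (x ∷_)) (++-split xs xs' ys ys' (suc-injective l) e')

take-++-length : ∀ {A : Set} (xs ys : List A) {n} → length xs ≡ n → take n (xs ++ ys) ≡ xs
take-++-length []       ys refl = refl
take-++-length (x ∷ xs) ys refl = cong (x ∷_) (take-++-length xs ys refl)

drop-++-length : ∀ {A : Set} (xs ys : List A) {n} → length xs ≡ n → drop n (xs ++ ys) ≡ ys
drop-++-length []       ys refl = refl
drop-++-length (x ∷ xs) ys refl = drop-++-length xs ys refl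

module Search {P : ℕ → Set} (P? : ∀ n → Dec (P n)) where

  least : ∀ x → P x → Σ ℕ λ m → P m × m ≤ x × (∀ y → y < m → ¬ P y)
  least = <-rec _ step
    where
      step : ∀ x → (∀ {y} → y < x → P y → Σ ℕ λ m → P m × m ≤ y × (∀ z → z < m → ¬ P z)) →
             P x → Σ ℕ λ m → P m × m ≤ x × (∀ y → y < m → ¬ P y)
      step x rec px with anyUpTo? P? x
      ... | no none = x , px , ≤-refl , λ y y<x py → none (y , y<x , py)
      ... | yes (y , y<x , py) with rec y<x py
      ...   | m , pm , m≤y , below = m , pm , ≤-trans m≤y (<⇒≤ y<x) , below

  greatest : ∀ n x → x < n → P x → Σ ℕ λ e → e < n × P e × (∀ y → e < y → y < n → ¬ P y)
  greatest (suc n) x x<1+n px with P? n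
  ... | yes pn = n , ≤-refl , pn , λ y n<y y<1+n → ⊥-elim (<⇒≱ n<y (≤-pred y<1+n))
  ... | no ¬pn with m<1+n⇒m<n∨m≡n x<1+n
  ...   | inj₂ refl = ⊥-elim (¬pn px)
  ...   | inj₁ x<n with greatest n x x<n px
  ...     | e , e<n , pe , above = e , m<n⇒m<1+n e<n , pe , above′
    where
      above′ : ∀ y → e < y → y < suc n → ¬ P y
      above′ y e<y y<1+n with m<1+n⇒m<n∨m≡n y<1+n
      ... | inj₁ y<n  = above y e<y y<n
      ... | inj₂ refl = ¬pn

module _ {k : ℕ} where

  palindrome? : (u : Word k) → Dec (IsPalindrome u)
  palindrome? u = ≡-dec _≟ᴸ_ (reverse u) u

  palExtend : ∀ (u : Word k) d → IsPalindrome (drop d u) → IsPalindrome (u ++ reverse (take d u))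
  palExtend u d p = begin
    reverse (u ++ reverse (take d u))           ≡⟨ reverse-++ u _ ⟩
    reverse (reverse (take d u)) ++ reverse u   ≡⟨ cong (_++ reverse u) (reverse-involutive _) ⟩
    take d u ++ reverse u                       ≡⟨ cong (λ v → take d u ++ reverse v) (sym (take++drop≡id d u)) ⟩
    take d u ++ reverse (take d u ++ drop d u)  ≡⟨ cong (take d u ++_) (reverse-++ (take d u) (drop d u)) ⟩
    take d u ++ (reverse (drop d u) ++ reverse (take d u)) ≡⟨ cong (λ v → take d u ++ (v ++ reverse (take d u))) p ⟩
    take d u ++ (drop d u ++ reverse (take d u)) ≡⟨ sym (++-assoc (take d u) _ _) ⟩
    (take d u ++ drop d u) ++ reverse (take d u) ≡⟨ cong (_++ reverse (take d u)) (take++drop≡id d u) ⟩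
    u ++ reverse (take d u)                      ∎

  palSuffix : ∀ (u y : Word k) → IsPalindrome (u ++ y) → length y ≤ length u → IsPalindrome (drop (length y) u)
  palSuffix u y p le = proj₁ (++-split (reverse dr) dr (reverse tk) y (length-reverse dr) (proj₂ outer))
    where
      tk = take (length y) u
      dr = drop (length y) u
      eq : reverse y ++ (reverse dr ++ reverse tk) ≡ tk ++ (dr ++ y)
      eq = begin
        reverse y ++ (reverse dr ++ reverse tk) ≡⟨ cong (reverse y ++_) (sym (reverse-++ tk dr)) ⟩
        reverse y ++ reverse (tk ++ dr)         ≡⟨ cong (λ v → reverse y ++ reverse v) (take++drop≡id (length y) u) ⟩
        reverse y ++ reverse u                  ≡⟨ sym (reverse-++ u y) ⟩
        reverse (u ++ y)                        ≡⟨ p ⟩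
        u ++ y                                  ≡⟨ cong (_++ y) (sym (take++drop≡id (length y) u)) ⟩
        (tk ++ dr) ++ y                         ≡⟨ ++-assoc tk dr y ⟩
        tk ++ (dr ++ y)                         ∎
      outer = ++-split (reverse y) tk _ _
                (trans (length-reverse y) (sym (trans (length-take (length y) u) (m≤n⇒m⊓n≡m le)))) eq

  palClosure : (u : Word k) → Σ (Word k) (IsPalClosure u)
  palClosure u with Search.least (λ d → palindrome? (drop d u)) (length u)
                      (subst IsPalindrome (sym (drop-all (length u) u ≤-refl)) refl)
  ... | d , pd , d≤ , below = u ++ reverse (take d u) , palExtend u d pd , (reverse (take d u) , refl) , shortest
    where
      len : length (u ++ reverse (take d u)) ≡ length u + d
      len = trans (length-++ u) (cong (length u +_)
              (trans (length-reverse (take d u)) (trans (length-take d u) (m≤n⇒m⊓n≡m d≤))))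
      d≤|y| : ∀ (y : Word k) → IsPalindrome (u ++ y) → d ≤ length y
      d≤|y| y p with length y ≤? length u
      ... | yes le = ≮⇒≥ (λ lt → below (length y) lt (palSuffix u y p le))
      ... | no nle = ≤-trans d≤ (<⇒≤ (≰⇒> nle))
      shortest : (q : Word k) → IsPalindrome q → IsPrefixW u q → length (u ++ reverse (take d u)) ≤ length q
      shortest q pq (y , refl) = subst₂ _≤_ (sym len) (sym (length-++ u)) (+-monoʳ-≤ (length u) (d≤|y| y pq))

slice-seg : ∀ {k} (s : InfWord k) i n → slice s i n ≡ seg s i n
slice-seg s i zero    = refl
slice-seg s i (suc n) = cong₂ _∷_ (cong s (+-identityʳ i))
  (trans (tabulate-cong (λ j → cong s (+-suc i (toℕ j)))) (slice-seg s (suc i) n))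

module PalindromicPrefixes {k : ℕ} (s : InfWord k) (ep : StandardEpisturmian s) where

  PalPrefix : ℕ → Set
  PalPrefix n = Mirror s 0 n

  Gap : ℕ → ℕ → Set
  Gap m n = ∀ e → m < e → e < n → ¬ PalPrefix e

  palPrefix? : ∀ n → Dec (PalPrefix n)
  palPrefix? n with palindrome? (seg s 0 n)
  ... | yes p = yes (palindrome⇒mirror s 0 n p)
  ... | no ¬p = no (λ m → ¬p (mirror⇒palindrome s 0 n m))

  closurePrefix : ∀ N → Σ ℕ λ L → N ≤ L × PalPrefix L ×
                  ((q : Word k) → IsPalindrome q → IsPrefixW (pref s N) q → L ≤ length q)
  closurePrefix N = fromClosure (palClosure (pref s N))
    where
      fromClosure : Σ (Word k) (IsPalClosure (pref s N)) → Σ ℕ λ L → N ≤ L × PalPrefix L ×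
                    ((q : Word k) → IsPalindrome q → IsPrefixW (pref s N) q → L ≤ length q)
      fromClosure (p , closure@(pal , (x , p≡) , shortest)) = length p , N≤|p| , mirror , shortest
        where
          N≤|p| : N ≤ length p
          N≤|p| = subst (N ≤_) (sym (trans (cong length p≡) (length-++ (pref s N))))
                    (subst (λ l → N ≤ l + length x) (sym (length-tabulate _)) (m≤m+n N (length x)))
          mirror : PalPrefix (length p)
          mirror = palindrome⇒mirror s 0 (length p)
                     (subst IsPalindrome (trans (ep N p closure) (slice-seg s 0 (length p))) pal)

  longPalPrefix : ∀ N → Σ ℕ λ n → N ≤ n × PalPrefix n
  longPalPrefix N = let n , N≤n , pal , _ = closurePrefix N in n , N≤n , pal

  previousPalPrefix : ∀ n → 0 < n → Σ ℕ λ m → m < n × PalPrefix m × Gap m n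
  previousPalPrefix n 0<n = Search.greatest palPrefix? n 0 0<n (λ x y ())

  -- If m and n are consecutive palindromic prefix lengths and s(d) ⋯ s(m) is a palindrome,
  -- then n ≤ m + 1 + d: the closure of s(0) ⋯ s(m) has length at most m + 1 + d.
  gapBound : ∀ m n → Gap m n → ∀ d e → d + e ≡ m → Mirror s d (suc e) → n ≤ suc m + d
  gapBound m n gap d e de mirror =
    let L , m<L , palL , shortest = closurePrefix (suc m) in
    ≤-trans (≮⇒≥ λ L<n → gap L m<L L<n palL) (subst (L ≤_) |q| (shortest q palq (reverse (take d u) , refl)))
    where
      u : Word k
      u = pref s (suc m)
      u≡ : u ≡ seg s 0 d ++ seg s d (suc e)
      u≡ = trans (slice-seg s 0 (suc m)) (trans (cong (seg s 0) (sym (trans (+-suc d e) (cong suc de)))) (seg-++ s 0 d (suc e)))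
      q : Word k
      q = u ++ reverse (take d u)
      take-u : take d u ≡ seg s 0 d
      take-u = trans (cong (take d) u≡) (take-++-length (seg s 0 d) (seg s d (suc e)) (length-seg s 0 d))
      drop-u : drop d u ≡ seg s d (suc e)
      drop-u = trans (cong (drop d) u≡) (drop-++-length (seg s 0 d) (seg s d (suc e)) (length-seg s 0 d))
      palq : IsPalindrome q
      palq = palExtend u d (subst IsPalindrome (sym drop-u) (mirror⇒palindrome s d (suc e) mirror))
      |q| : length q ≡ suc m + d
      |q| = trans (length-++ u) (cong₂ _+_ (length-tabulate {n = suc m} (λ j → s (toℕ j)))
              (trans (length-reverse (take d u)) (trans (cong length take-u) (length-seg s 0 d))))

  private
    mirror-arith : ∀ j j' l l' → suc (j' + l + (j + l')) ≡ j + suc (l + l') + j'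
    mirror-arith = solve-∀

    reflect-arith : ∀ j j' L → j + L + j' ≡ j' + L + j
    reflect-arith = solve-∀

  mirrored : ∀ n j j' L → PalPrefix n → j + L + j' ≡ n →
             ∀ l l' → suc (l + l') ≡ L → s (j' + l) ≡ s (j + l')
  mirrored n j j' L pal e l l' ll' =
    pal (j' + l) (j + l') (trans (mirror-arith j j' l l') (trans (cong (λ x → j + x + j') ll') e))

  -- A pattern of length L > 0 whose occurrences are mirrored by palindromic prefixes,
  -- and which cannot straddle the centre between consecutive palindromic prefixes m < n,
  -- never occurs: an occurrence in a palindromic prefix n lies inside the previous one, or its
  -- mirror image does, or it straddles.
  noOccurrence : ∀ L (Occ : ℕ → Set) → 0 < L →
    (∀ n j j' → PalPrefix n → j + L + j' ≡ n → Occ j → Occ j') →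
    (∀ m n j → PalPrefix m → PalPrefix n → Gap m n → Occ j → m < j + L → m + j < n → ⊥) →
    ∀ j → ¬ Occ j
  noOccurrence L Occ 0<L reflect straddle j occ =
    let n , j+L≤n , pal = longPalPrefix (j + L) in <-rec Descent step n pal j j+L≤n occ
    where
      Descent : ℕ → Set
      Descent n = PalPrefix n → ∀ j → j + L ≤ n → Occ j → ⊥

      -- the mirror image of a factor not ending before the centre lies in the first half
      mirrorInside : ∀ {j j' m n} → j + L + j' ≡ n → n ≤ m + j → j' + L ≤ m
      mirrorInside {j} {j'} {m} e n≤ = +-cancelʳ-≤ j (j' + L) m (subst (_≤ m + j) (trans (sym e) (reflect-arith j j' L)) n≤)

      step : ∀ n → (∀ {m} → m < n → Descent m) → Descent n
      step n descend pal j j+L≤n occ with previousPalPrefix n (≤-trans 0<L (≤-trans (m≤n+m L j) j+L≤n))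
      ... | m , m<n , palm , gap with j + L ≤? m | n ≤? m + j
      ...   | yes inside | _            = descend m<n palm j inside occ
      ...   | no ¬inside | no ¬mirrored = straddle m n j palm pal gap occ (≰⇒> ¬inside) (≰⇒> ¬mirrored)
      ...   | no _       | yes mirrored =
        let j' , e = m≤n⇒∃[o]m+o≡n j+L≤n in descend m<n palm j' (mirrorInside e mirrored) (reflect n j j' pal e occ)

left< : ∀ {x y z} → suc (x + y) ≡ z → x < z
left< {x} {y} e = subst (x <_) e (s≤s (m≤m+n x y))

right< : ∀ {x y z} → suc (x + y) ≡ z → y < z
right< {x} {y} e = subst (y <_) e (s≤s (m≤n+m y x))

module _ {k : ℕ} (s : InfWord k) (a : Letter k) where

  Run : ℕ → ℕ → Set
  Run j L = ∀ l → l < L → s (j + l) ≡ a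

  BoundedRun : ℕ → ℕ → Set
  BoundedRun j r = ¬ s j ≡ a × Run (suc j) r × ¬ s (suc j + r) ≡ a

  inRun : ∀ {j L} → Run j L → ∀ {p} → j ≤ p → p < j + L → s p ≡ a
  inRun {j} {L} run j≤p p<end with m≤n⇒∃[o]m+o≡n j≤p
  ... | o , refl = run o (+-cancelˡ-< j o L p<end)

  runMirror : ∀ {j L} → Run j L → Mirror s j L
  runMirror run x y e = trans (run x (left< e)) (sym (run y (right< e)))

module PrefixRuns {k : ℕ} (s : InfWord k) (ep : StandardEpisturmian s) (a : Letter k) (P : ℕ)
                  (prefixRun : Run s a 0 P) (afterPrefix : ¬ s P ≡ a) where
  open PalindromicPrefixes s ep

  mirrorOfPrefix : ∀ {m} → PalPrefix m → ∀ x y → suc (x + y) ≡ m → y < P → s x ≡ a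
  mirrorOfPrefix pal x y e y<P = trans (pal x y e) (prefixRun y y<P)

  -- Consecutive palindromic prefixes m < n satisfy n ≤ 2m + 1, as s(m) alone is a palindrome.
  doubleBound : ∀ m n → Gap m n → n ≤ suc m + m
  doubleBound m n gap = gapBound m n gap m 0 (+-identityʳ m) single
    where
      single : Mirror s m 1
      single zero zero _ = refl

  -- If the palindromic prefix m = d + P is followed by s(m) = a, then s(d) ⋯ s(m) mirrors
  -- a^P a, so the next palindromic prefix n satisfies n ≤ m + 1 + d.
  tight : ∀ m n d → PalPrefix m → Gap m n → s m ≡ a → d + P ≡ m → n ≤ suc m + d
  tight m n d pal gap sm e = gapBound m n gap d P e (runMirror s a block)
    where
      block : Run s a d (suc P)
      block x x<1+P with m<1+n⇒m<n∨m≡n x<1+P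
      ... | inj₂ refl = subst (λ p → s p ≡ a) (sym e) sm
      ... | inj₁ x<P with m≤n⇒∃[o]m+o≡n x<P
      ...   | y , ey = mirrorOfPrefix pal (d + x) y (trans (arith d x y) (trans (cong (d +_) ey) e)) (right< ey)
        where
          arith : ∀ d x y → suc (d + x + y) ≡ d + suc (x + y)
          arith = solve-∀

  startBound : ∀ {m n j d} → m + j < n → n ≤ suc m + d → j ≤ d
  startBound {m} {n} {j} {d} m+j<n n≤ = +-cancelˡ-≤ m j d (≤-pred (≤-trans m+j<n n≤))

  squeeze : ∀ {m n j} → m + j < n → n ≤ suc m + j → n ≡ suc (m + j)
  squeeze m+j<n n≤ = ≤-antisym n≤ m+j<n

  reflectRun : ∀ L n j j' → PalPrefix n → j + L + j' ≡ n → Run s a j L → Run s a j' L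
  reflectRun L n j j' pal e run l l<L with m≤n⇒∃[o]m+o≡n l<L
  ... | l' , ll' = trans (mirrored n j j' L pal e l l' ll') (run l' (right< ll'))

  noLongRun : ∀ j → ¬ Run s a j (suc (suc P))
  noLongRun = noOccurrence Q (λ j → Run s a j Q) (s≤s z≤n) (reflectRun Q) straddle
    where
      Q = suc (suc P)
      straddle : ∀ m n j → PalPrefix m → PalPrefix n → Gap m n → Run s a j Q → m < j + Q → m + j < n → ⊥
      straddle m n j palm paln gap run m<end m+j<n = cases (m ≤? P)
        where
          covered : ∀ {p} → j ≤ p → p < j + Q → s p ≡ a
          covered = inRun s a run
          j≤m : j ≤ m
          j≤m = startBound m+j<n (doubleBound m n gap)
          sm : s m ≡ a
          sm = covered j≤m m<end
          -- m = d₀ + 1 + P: the letter s(d₀) mirrors s(P) ≠ a in the prefix m, and j ≤ d₀ + 1.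
          beyondPrefix : ∀ d₀ → suc (d₀ + P) ≡ m → ⊥
          beyondPrefix d₀ e with m≤n⇒m<n∨m≡n (startBound m+j<n (tight m n (suc d₀) palm gap sm e))
          -- the block covers position d₀
          ... | inj₁ j≤d₀ = afterPrefix (trans (sym (palm d₀ P e)) (covered (≤-pred j≤d₀) (<-trans (left< e) m<end)))
          -- the block starts at d₀ + 1, so n = m + 1 + j mirrors s(m + 1) = a onto s(d₀)
          ... | inj₂ refl = afterPrefix (trans (sym (palm d₀ P e)) (trans (sym (paln (suc m) d₀ n≡)) sm+1))
            where
              n≡ : suc (suc m + d₀) ≡ n
              n≡ = trans (cong suc (sym (+-suc m d₀))) (sym (squeeze {m} {n} {suc d₀} m+j<n (tight m n (suc d₀) palm gap sm e)))
              sm+1 : s (suc m) ≡ a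
              sm+1 = covered (s≤s (<⇒≤ (left< e)))
                       (subst (λ p → suc p < suc d₀ + Q) e
                         (s≤s (≤-reflexive (sym (trans (+-suc d₀ (suc P)) (cong suc (+-suc d₀ P)))))))
          cases : Dec (m ≤ P) → ⊥
          -- the block covers position P
          cases (yes m≤P) = afterPrefix (covered (≤-trans j≤m m≤P) (≤-trans (n≤1+n (suc P)) (m≤n+m Q j)))
          cases (no m≰P) with m≤n⇒∃[o]m+o≡n (≰⇒> m≰P)
          ... | d₀ , e = beyondPrefix d₀ (trans (cong suc (+-comm d₀ P)) e)

  reflectBoundedRun : ∀ r n j j' → PalPrefix n → j + suc (suc r) + j' ≡ n → BoundedRun s a j r → BoundedRun s a j' r
  reflectBoundedRun r n j j' pal e (first , inner , last) = first' , inner' , last'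
    where
      facing = mirrored n j j' (suc (suc r)) pal e
      first' : ¬ s j' ≡ a
      first' h = last (trans (at-suc s j r) (trans (sym (facing 0 (suc r) refl)) (trans (sym (at-zero s j')) h)))
      last' : ¬ s (suc j' + r) ≡ a
      last' h = first (trans (at-zero s j)
                  (trans (sym (facing (suc r) 0 (cong (λ x → suc (suc x)) (+-identityʳ r)))) (trans (sym (at-suc s j' r)) h)))
      inner' : Run s a (suc j') r
      inner' l l<r with m≤n⇒∃[o]m+o≡n l<r
      ... | l'' , e'' = trans (at-suc s j' l)
                          (trans (facing (suc l) (suc l'') (cong suc (trans (+-suc (suc l) l'') (cong suc e''))))
                            (trans (sym (at-suc s j l'')) (inner l'' (right< e''))))

  noShortRun : ∀ r → r < P → ∀ j → ¬ BoundedRun s a j r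
  noShortRun r r<P = noOccurrence (suc (suc r)) (λ j → BoundedRun s a j r) (s≤s z≤n) (reflectBoundedRun r) straddle
    where
      straddle : ∀ m n j → PalPrefix m → PalPrefix n → Gap m n → BoundedRun s a j r →
                 m < j + suc (suc r) → m + j < n → ⊥
      straddle m n j palm paln gap (first , inner , last) m<end m+j<n = cases (j <? P)
        where
          j≤m : j ≤ m
          j≤m = startBound m+j<n (doubleBound m n gap)
          -- The run starts at the centre m = j (and m = (r + 1) + y): then n = 2m + 1, and
          -- s(j + r + 1) mirrors (in n, then in m) the letter s(r) of the a-prefix.
          atCentre : j ≡ m → ∀ y → suc r + y ≡ m → ⊥
          atCentre j≡m y ey = last (begin
            s (suc j + r)  ≡⟨ cong s (trans (sym (+-suc j r)) (cong (_+ suc r) j≡m)) ⟩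
            s (m + suc r)  ≡⟨ paln (m + suc r) y n≡ ⟩
            s y            ≡⟨ mirrorOfPrefix palm y r (trans (cong suc (+-comm y r)) ey) r<P ⟩
            a              ∎)
            where
              n≡ : suc (m + suc r + y) ≡ n
              n≡ = trans (cong suc (trans (+-assoc m (suc r) y) (cong (m +_) ey)))
                     (sym (squeeze {m} {n} {m} (subst (λ x → m + x < n) j≡m m+j<n) (doubleBound m n gap)))
          -- The centre m = j + 1 + l lies inside the run (l < r): with m = P + d, s(m) = a
          -- forces j ≤ d, i.e. P ≤ l + 1 ≤ r.
          insideRun : ∀ l → j + suc l ≡ m → l < r → ∀ d → P + d ≡ m → ⊥
          insideRun l e l<r d P+d≡m = <⇒≱ r<P (≤-trans P≤1+l l<r)
            where
              sm : s m ≡ a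
              sm = subst (λ p → s p ≡ a) (trans (sym (+-suc j l)) e) (inner l l<r)
              j≤d : j ≤ d
              j≤d = startBound m+j<n (tight m n d palm gap sm (trans (+-comm d P) P+d≡m))
              P≤1+l : P ≤ suc l
              P≤1+l = +-cancelˡ-≤ j P (suc l) (subst (j + P ≤_) (trans (+-comm d P) (trans P+d≡m (sym e))) (+-monoˡ-≤ P j≤d))
          centreAt : P ≤ j → (Σ ℕ λ o → j + o ≡ m) → ⊥
          centreAt P≤j (zero , e) =
            let y , ey = m≤n⇒∃[o]m+o≡n (≤-trans (≤-trans r<P P≤j) j≤m) in
            atCentre (trans (sym (+-identityʳ j)) e) y ey
          centreAt P≤j (suc l , e) with m≤n⇒m<n∨m≡n (≤-pred (≤-pred (+-cancelˡ-< j (suc l) (suc (suc r)) (subst (_< j + suc (suc r)) (sym e) m<end))))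
          -- the centre is the closing letter s(j + r + 1) ≠ a, which mirrors s(j) onto s(r) = a
          ... | inj₂ refl = first (trans (palm j r (trans (sym (+-suc j r)) e)) (prefixRun r r<P))
          ... | inj₁ l<r = let d , P+d≡m = m≤n⇒∃[o]m+o≡n (≤-trans P≤j j≤m) in insideRun l e l<r d P+d≡m
          cases : Dec (j < P) → ⊥
          -- the run starts inside the a-prefix
          cases (yes j<P) = first (prefixRun j j<P)
          cases (no j≮P) = centreAt (≮⇒≥ j≮P) (m≤n⇒∃[o]m+o≡n j≤m)

-- Run lengths in a standard episturmian word: if a^q occurs as a maximal run between two
-- other letters, then a^(q+2) is not a factor: writing s = a^P b ⋯, maximal runs have length
-- at least P, while a^(P+2) never occurs.
runGap : ∀ {k} (s : InfWord k) → StandardEpisturmian s → ∀ a j q j' → BoundedRun s a j q → ¬ Run s a j' (suc (suc q))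
runGap s ep a j q j' bounded run with Search.least (λ x → ¬? (s x ≟ᴸ a)) j (proj₁ bounded)
... | P , afterPrefix , _ , beforeP = noLongRun j' (λ l l<P+2 → run l (≤-trans l<P+2 (s≤s (s≤s P≤q))))
  where
    open PrefixRuns s ep a P (λ x x<P → decidable-stable (s x ≟ᴸ a) (beforeP x x<P)) afterPrefix
    P≤q : P ≤ q
    P≤q = ≮⇒≥ (λ q<P → noShortRun q q<P j bounded)

module Morphisms {k : ℕ} (a : Letter k) where

  ψ-letter-a : ∀ x → x ≡ a → ψ-letter a x ≡ a ∷ []
  ψ-letter-a x x≡a with x ≟ᴸ a
  ... | yes _   = refl
  ... | no x≢a = ⊥-elim (x≢a x≡a)

  ψ-letter-b : ∀ x → ¬ x ≡ a → ψ-letter a x ≡ a ∷ x ∷ []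
  ψ-letter-b x x≢a with x ≟ᴸ a
  ... | yes x≡a = ⊥-elim (x≢a x≡a)
  ... | no _    = refl

  ψ-letter-∷ʳ : ∀ x → ψ-letter a x ++ a ∷ [] ≡ a ∷ ψ̄-letter a x
  ψ-letter-∷ʳ x with x ≟ᴸ a
  ... | yes _ = refl
  ... | no _  = refl

  ψ-∷ʳ : ∀ (u : Word k) → ψ a u ++ a ∷ [] ≡ a ∷ ψ̄ a u
  ψ-∷ʳ []      = refl
  ψ-∷ʳ (x ∷ u) = begin
    (ψ-letter a x ++ ψ a u) ++ a ∷ []   ≡⟨ ++-assoc (ψ-letter a x) (ψ a u) _ ⟩
    ψ-letter a x ++ (ψ a u ++ a ∷ [])   ≡⟨ cong (ψ-letter a x ++_) (ψ-∷ʳ u) ⟩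
    ψ-letter a x ++ a ∷ ψ̄ a u           ≡⟨ sym (++-assoc (ψ-letter a x) (a ∷ []) (ψ̄ a u)) ⟩
    (ψ-letter a x ++ a ∷ []) ++ ψ̄ a u   ≡⟨ cong (_++ ψ̄ a u) (ψ-letter-∷ʳ x) ⟩
    a ∷ ψ̄-letter a x ++ ψ̄ a u           ∎

module Image {k : ℕ} (a : Letter k) (t z : InfWord k) (img : IsImageψ a t z) where
  open Morphisms a

  -- cut n = |ψ_a(t(0) ⋯ t(n-1))| is the position in z where the block of t(n) begins.
  cut : ℕ → ℕ
  cut n = length (ψ a (seg t 0 n))

  imagePrefix : ∀ n → ψ a (seg t 0 n) ≡ seg z 0 (cut n)
  imagePrefix n = subst (λ v → ψ a v ≡ seg z 0 (length (ψ a v))) (slice-seg t 0 n) (trans (img n) (slice-seg z 0 _))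

  imageFactor : ∀ n L → cut (n + L) ≡ cut n + length (ψ a (seg t n L)) ×
                        ψ a (seg t n L) ≡ seg z (cut n) (length (ψ a (seg t n L)))
  imageFactor n L = |split| , ++-cancelˡ (seg z 0 (cut n)) _ _ prefixes
    where
      image = ψ a (seg t n L)
      split : ψ a (seg t 0 (n + L)) ≡ ψ a (seg t 0 n) ++ image
      split = trans (cong (ψ a) (seg-++ t 0 n L)) (concatMap-++ (ψ-letter a) (seg t 0 n) (seg t n L))
      |split| : cut (n + L) ≡ cut n + length image
      |split| = trans (cong length split) (length-++ (ψ a (seg t 0 n)))
      prefixes : seg z 0 (cut n) ++ image ≡ seg z 0 (cut n) ++ seg z (cut n) (length image)
      prefixes = begin
        seg z 0 (cut n) ++ image                      ≡⟨ cong (_++ image) (sym (imagePrefix n)) ⟩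
        ψ a (seg t 0 n) ++ image                      ≡⟨ sym split ⟩
        ψ a (seg t 0 (n + L))                         ≡⟨ imagePrefix (n + L) ⟩
        seg z 0 (cut (n + L))                         ≡⟨ cong (seg z 0) |split| ⟩
        seg z 0 (cut n + length image)                ≡⟨ seg-++ z 0 (cut n) (length image) ⟩
        seg z 0 (cut n) ++ seg z (cut n) (length image) ∎

  imageLetter : ∀ n v → ψ-letter a (t n) ≡ v → cut (suc n) ≡ cut n + length v × v ≡ seg z (cut n) (length v)
  imageLetter n v e with imageFactor n 1
  ... | |split| , block rewrite ++-identityʳ (ψ-letter a (t n)) | e =
    trans (cong cut (+-comm 1 n)) |split| , block

  blockA : ∀ n → t n ≡ a → z (cut n) ≡ a × cut (suc n) ≡ suc (cut n)
  blockA n tn≡a with imageLetter n (a ∷ []) (ψ-letter-a (t n) tn≡a)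
  ... | next , block = sym (∷-injectiveˡ block) , trans next (+-comm (cut n) 1)

  blockB : ∀ n → ¬ t n ≡ a → z (cut n) ≡ a × z (suc (cut n)) ≡ t n × cut (suc n) ≡ suc (suc (cut n))
  blockB n tn≢a with imageLetter n (a ∷ t n ∷ []) (ψ-letter-b (t n) tn≢a)
  ... | next , block = sym (∷-injectiveˡ block) , sym (∷-injectiveˡ (∷-injectiveʳ block)) , trans next (+-comm (cut n) 2)

  cutIsA : ∀ n → z (cut n) ≡ a
  cutIsA n with t n ≟ᴸ a
  ... | yes tn≡a = proj₁ (blockA n tn≡a)
  ... | no tn≢a  = proj₁ (blockB n tn≢a)

  cut-suc : ∀ n → cut n < cut (suc n)
  cut-suc n with t n ≟ᴸ a
  ... | yes tn≡a = ≤-reflexive (sym (proj₂ (blockA n tn≡a)))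
  ... | no tn≢a  = ≤-trans (n≤1+n _) (≤-reflexive (sym (proj₂ (proj₂ (blockB n tn≢a)))))

  cut-reflects-≤ : ∀ n n' → cut n ≤ cut n' → n ≤ n'
  cut-reflects-≤ n n' le = ≮⇒≥ (λ n'<n → <⇒≱ (increasing n' n n'<n) le)
    where
      increasing : ∀ n n' → n < n' → cut n < cut n'
      increasing n (suc n') n<1+n' with m<1+n⇒m<n∨m≡n n<1+n'
      ... | inj₁ n<n' = <-trans (increasing n n' n<n') (cut-suc n')
      ... | inj₂ refl = cut-suc n

  position : ∀ p → Σ ℕ λ n → p ≡ cut n ⊎ (p ≡ suc (cut n) × ¬ t n ≡ a)
  position zero = 0 , inj₁ refl
  position (suc p) with position p
  ... | n , inj₂ (refl , tn≢a) = suc n , inj₁ (sym (proj₂ (proj₂ (blockB n tn≢a))))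
  ... | n , inj₁ refl with t n ≟ᴸ a
  ...   | yes tn≡a = suc n , inj₁ (sym (proj₂ (blockA n tn≡a)))
  ...   | no tn≢a  = n , inj₂ (refl , tn≢a)

  aIsCut : ∀ p → z p ≡ a → Σ ℕ λ n → p ≡ cut n
  aIsCut p zp≡a with position p
  ... | n , inj₁ p≡cut = n , p≡cut
  ... | n , inj₂ (refl , tn≢a) = ⊥-elim (tn≢a (trans (sym (proj₁ (proj₂ (blockB n tn≢a)))) zp≡a))

  isolated : ∀ p → ¬ z p ≡ a → Σ ℕ λ p₀ → p ≡ suc p₀ × z p₀ ≡ a × z (suc p) ≡ a
  isolated p zp≢a with position p
  ... | n , inj₁ refl = ⊥-elim (zp≢a (cutIsA n))
  ... | n , inj₂ (refl , tn≢a) =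
    cut n , refl , cutIsA n , subst (λ q → z q ≡ a) (proj₂ (proj₂ (blockB n tn≢a))) (cutIsA (suc n))

  imageBetweenAs : ∀ i W → z i ≡ a → z (i + W) ≡ a → Σ (Word k) λ u → IsFactor u t × seg z i W ≡ ψ a u
  imageBetweenAs i W zi≡a zend≡a with aIsCut i zi≡a | aIsCut (i + W) zend≡a
  ... | n , refl | n' , e' with m≤n⇒∃[o]m+o≡n (cut-reflects-≤ n n' (subst (cut n ≤_) e' (m≤m+n (cut n) W)))
  ...   | L , refl with imageFactor n L
  ...     | |split| , block = seg t n L , factor , sym (trans block (cong (seg z (cut n)) |image|≡W))
    where
      factor : IsFactor (seg t n L) t
      factor = n , sym (trans (cong (slice t n) (length-seg t n L)) (slice-seg t n L))
      |image|≡W : length (ψ a (seg t n L)) ≡ W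
      |image|≡W = +-cancelˡ-≡ (cut n) _ _ (trans (sym |split|) (sym e'))

-- Rotating w = z(i) ⋯ z(i+d+e-1) by d letters gives the conjugate z(i+d) ⋯ z(i+d+e-1) z(i) ⋯ z(i+d-1);
-- if it is a factor of z, it occurs at some position j, compared here letter by letter.
rotation : ∀ {k} (z : InfWord k) i d e (w : Word k) → w ≡ seg z i (d + e) →
           ((w' : Word k) → IsConjugate w w' → IsFactor w' z) →
           Σ ℕ λ j → (∀ l → l < e → z (j + l) ≡ z (i + d + l)) × (∀ l → l < d → z (j + e + l) ≡ z (i + l))
rotation z i d e w w≡ conj with conj (seg z (i + d) e ++ seg z i d) (seg z i d , seg z (i + d) e , trans w≡ (seg-++ z i d e) , refl)
... | j , w'≡ = j , (λ l l<e → sym (seg-pointwise z z (i + d) j e (proj₁ halves) l l<e))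
                  , (λ l l<d → sym (seg-pointwise z z i (j + e) d (proj₂ halves) l l<d))
  where
    |w'| : length (seg z (i + d) e ++ seg z i d) ≡ e + d
    |w'| = trans (length-++ (seg z (i + d) e)) (cong₂ _+_ (length-seg z (i + d) e) (length-seg z i d))
    halves = ++-split (seg z (i + d) e) (seg z j e) (seg z i d) (seg z (j + e) d)
               (trans (length-seg z (i + d) e) (sym (length-seg z j e)))
               (trans w'≡ (trans (cong (slice z j) |w'|) (trans (slice-seg z j (e + d)) (seg-++ z j e d))))

runAll : ∀ {k} (s : InfWord k) a i n → Run s a i n → All (_≡ a) (seg s i n)
runAll s a i zero    run = []
runAll s a i (suc n) run = subst (_≡ a) (sym (at-zero s i)) (run 0 (s≤s z≤n))
                         ∷ runAll s a (suc i) n (λ l l<n → trans (at-suc s i l) (run (suc l) (s≤s l<n)))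

module Decomposition {k : ℕ} (a : Letter k) (t z : InfWord k) (epz : StandardEpisturmian z) (img : IsImageψ a t z) where
  open Morphisms a
  open Image a t z img

  Decomposes : Word k → Set
  Decomposes w = Σ (Word k) λ u → IsFactor u t × ((w ≡ ψ a u) ⊎ (w ≡ ψ̄ a u))

  viaψ : ∀ i W w → w ≡ seg z i W → z i ≡ a → z (i + W) ≡ a → Decomposes w
  viaψ i W w w≡ zi≡a zend≡a with imageBetweenAs i W zi≡a zend≡a
  ... | u , factor , image = u , factor , inj₁ (trans w≡ image)

  -- w = z(i+1) ⋯ z(i+W) is preceded by a and ends with a: a w = ψ_a(u) a = a ψ̄_a(u).
  viaψ̄ : ∀ i W w → w ≡ seg z (suc i) W → z i ≡ a → z (i + W) ≡ a → Decomposes w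
  viaψ̄ i W w w≡ zi≡a zend≡a with imageBetweenAs i W zi≡a zend≡a
  ... | u , factor , image = u , factor , inj₂ (∷-injectiveʳ (begin
    a ∷ w                   ≡⟨ cong₂ _∷_ (sym zi≡a) w≡ ⟩
    seg z i (suc W)         ≡⟨ seg-∷ʳ z i W ⟩
    seg z i W ∷ʳ z (i + W)  ≡⟨ cong₂ _∷ʳ_ image zend≡a ⟩
    ψ a u ++ a ∷ []         ≡⟨ ψ-∷ʳ u ⟩
    a ∷ ψ̄ a u               ∎))

  module _ (i W₁ : ℕ) (w : Word k) (w≡ : w ≡ seg z i (suc W₁)) (0<W₁ : 0 < W₁)
           (conj : (w' : Word k) → IsConjugate w w' → IsFactor w' z) where

    rotate : ∀ d e → d + e ≡ suc W₁ →
             Σ ℕ λ j → (∀ l → l < e → z (j + l) ≡ z (i + d + l)) × (∀ l → l < d → z (j + e + l) ≡ z (i + l))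
    rotate d e d+e≡ = rotation z i d e w (trans w≡ (cong (seg z i) (sym d+e≡))) conj

    rotatedFirst : ∀ d e j → 0 < e → (∀ l → l < e → z (j + l) ≡ z (i + d + l)) → z j ≡ z (i + d)
    rotatedFirst d e j 0<e toFront = trans (at-zero z _) (trans (toFront 0 0<e) (sym (at-zero z _)))

    wrappedFirst : ∀ d e j → 0 < d → (∀ l → l < d → z (j + e + l) ≡ z (i + l)) → z (j + e) ≡ z i
    wrappedFirst d e j 0<d toBack = trans (at-zero z _) (trans (toBack 0 0<d) (sym (at-zero z _)))

    -- w begins with a letter b ≠ a, so it is preceded by a. If w ends with a, then w = ψ̄_a(u);
    -- otherwise the conjugate moving its last letter to the front begins with two letters ≠ a.
    startsWithB : ¬ z i ≡ a → Decomposes w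
    startsWithB zi≢a with isolated i zi≢a
    ... | i₀ , refl , zi₀≡a , _ with z (suc i₀ + W₁) ≟ᴸ a
    ...   | yes zlast≡a = viaψ̄ i₀ (suc W₁) w w≡ zi₀≡a (trans (cong z (+-suc i₀ W₁)) zlast≡a)
    ...   | no zlast≢a with rotate W₁ 1 (+-comm W₁ 1)
    ...     | j , toFront , toBack with isolated j (λ zj≡a → zlast≢a (trans (sym (rotatedFirst W₁ 1 j (s≤s z≤n) toFront)) zj≡a))
    ...       | _ , _ , _ , zj+1≡a =
      ⊥-elim (zi≢a (trans (sym (wrappedFirst W₁ 1 j 0<W₁ toBack)) (trans (cong z (+-comm j 1)) zj+1≡a)))

    -- w = a b ⋯ with b ≠ a. Moving the first a to the end gives a conjugate b ⋯ a occurring at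
    -- some j; as z(j) ≠ a, z(j - 1) = a, so w occurs at j - 1 and is followed by a: w = ψ_a(u).
    secondIsB : z i ≡ a → ¬ z (suc i) ≡ a → Decomposes w
    secondIsB zi≡a zi+1≢a with rotate 1 W₁ refl
    ... | j , toFront , toBack with isolated j (λ zj≡a → zi+1≢a (trans (cong z (+-comm 1 i)) (trans (sym (rotatedFirst 1 W₁ j 0<W₁ toFront)) zj≡a)))
    ...   | j₀ , refl , zj₀≡a , _ = viaψ j₀ (suc W₁) w w≡' zj₀≡a zend≡a
      where
        w≡' : w ≡ seg z j₀ (suc W₁)
        w≡' = trans w≡ (cong₂ _∷_ (trans zi≡a (sym zj₀≡a))
                (seg-ext z z (suc i) (suc j₀) W₁ λ l l<W₁ → trans (cong (λ p → z (p + l)) (+-comm 1 i)) (sym (toFront l l<W₁))))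
        zend≡a : z (j₀ + suc W₁) ≡ a
        zend≡a = trans (cong z (+-suc j₀ W₁)) (trans (wrappedFirst 1 W₁ (suc j₀) (s≤s z≤n) toBack) zi≡a)

    nonA? : ∀ l → Dec (¬ z (i + l) ≡ a)
    nonA? l = ¬? (z (i + l) ≟ᴸ a)

    lastNonA : ¬ IsLetterPower w →
               Σ ℕ λ e → e < suc W₁ × ¬ z (i + e) ≡ a × (∀ y → e < y → y < suc W₁ → z (i + y) ≡ a)
    lastNonA notPower with anyUpTo? nonA? (suc W₁)
    ... | yes (x , x<W , zx≢a) with Search.greatest nonA? (suc W₁) x x<W zx≢a
    ...   | e , e<W , ze≢a , above = e , e<W , ze≢a , λ y e<y y<W → decidable-stable (z (i + y) ≟ᴸ a) (above y e<y y<W)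
    lastNonA notPower | no none = ⊥-elim (notPower (a , subst (All (_≡ a)) (sym w≡)
      (runAll z a i (suc W₁) λ l l<W → decidable-stable (z (i + l) ≟ᴸ a) λ zl≢a → none (l , l<W , zl≢a))))

    private
      run-arith : ∀ p e l → suc (p + e) + l ≡ p + (suc e + l)
      run-arith = solve-∀

      end-arith : ∀ p e q → suc (p + e) + suc q ≡ p + suc (suc e + q)
      end-arith = solve-∀

    -- w = a a ⋯ b a^(q+1), b ≠ a being its last letter ≠ a, is followed by a letter ≠ a. Then
    -- a^(q+1) is a maximal run of z, whereas the conjugate a^(q+1) a a ⋯ contains a^(q+3).
    twoLeadingAs : ¬ IsLetterPower w → z i ≡ a → z (suc i) ≡ a → z (i + W₁) ≡ a → ¬ z (i + suc W₁) ≡ a → ⊥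
    twoLeadingAs notPower zi≡a zi+1≡a zlast≡a zafter≢a with lastNonA notPower
    ... | e , e<W , ze≢a , above with m<1+n⇒m<n∨m≡n e<W
    ...   | inj₂ refl = ze≢a zlast≡a
    ...   | inj₁ e<W₁ with m≤n⇒∃[o]m+o≡n e<W₁
    ...     | q , e+1+q≡W₁ with rotate (suc e) (suc q) (trans (+-suc (suc e) q) (cong suc e+1+q≡W₁))
    ...       | j , toFront , toBack = runGap z epz a (i + e) (suc q) j (ze≢a , finalRun , after≢a) longRun
      where
        finalRun : Run z a (suc (i + e)) (suc q)
        finalRun l l≤q = subst (λ p → z p ≡ a) (sym (run-arith i e l))
          (above (suc e + l) (s≤s (m≤m+n e l)) (s≤s (subst (suc e + l ≤_) e+1+q≡W₁ (+-monoʳ-≤ (suc e) (≤-pred l≤q)))))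
        after≢a : ¬ z (suc (i + e) + suc q) ≡ a
        after≢a h = zafter≢a (subst (λ p → z p ≡ a) (trans (end-arith i e q) (cong (λ x → i + suc x) e+1+q≡W₁)) h)
        positive : ∀ x → ¬ z (i + x) ≡ a → 1 ≤ x
        positive zero    zx≢a = ⊥-elim (zx≢a (trans (sym (at-zero z i)) zi≡a))
        positive (suc _) _    = s≤s z≤n
        leadingAs : Run z a i 2
        leadingAs zero    _ = trans (sym (at-zero z i)) zi≡a
        leadingAs (suc zero) _ = trans (cong z (+-comm i 1)) zi+1≡a
        leadingAs (suc (suc _)) (s≤s (s≤s ()))
        longRun : Run z a j (suc (suc (suc q)))
        longRun l l<q+3 with l <? suc q
        ... | yes l<q+1 = trans (toFront l l<q+1) (subst (λ p → z p ≡ a) (cong (_+ l) (sym (+-suc i e))) (finalRun l l<q+1))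
        ... | no l≮q+1 with m≤n⇒∃[o]m+o≡n (≮⇒≥ l≮q+1)
        ...   | l' , refl = trans (cong z (sym (+-assoc j (suc q) l'))) (trans (toBack l' (≤-trans l'<2 (s≤s (positive e ze≢a)))) (leadingAs l' l'<2))
          where
            l'<2 : l' < 2
            l'<2 = +-cancelˡ-< (suc q) l' 2 (subst (suc q + l' <_) (cong suc (+-comm 2 q)) l<q+3)

    decompose : ¬ IsLetterPower w → Decomposes w
    decompose notPower with z i ≟ᴸ a
    ... | no zi≢a = startsWithB zi≢a
    ... | yes zi≡a with z (i + suc W₁) ≟ᴸ a
    ...   | yes zafter≡a = viaψ i (suc W₁) w w≡ zi≡a zafter≡a
    ...   | no zafter≢a with isolated (i + suc W₁) zafter≢a | z (suc i) ≟ᴸ a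
    ...     | _ , _ , _ , _ | no zi+1≢a = secondIsB zi≡a zi+1≢a
    ...     | p₀ , after≡ , zp₀≡a , _ | yes zi+1≡a = ⊥-elim (twoLeadingAs notPower zi≡a zi+1≡a zlast≡a zafter≢a)
      where
        zlast≡a : z (i + W₁) ≡ a
        zlast≡a = subst (λ p → z p ≡ a) (sym (suc-injective (trans (sym (+-suc i W₁)) after≡))) zp₀≡a

proposition6p9 : (k : ℕ) (a : Letter k) (t z : InfWord k) →
    StandardEpisturmian t → StandardEpisturmian z → IsImageψ a t z →
    (w : Word k) → IsFactor w z → 1 < length w → ¬ IsLetterPower w →
    ((w' : Word k) → IsConjugate w w' → IsFactor w' z) →
    Σ (Word k) λ u → IsFactor u t × ((w ≡ ψ a u) ⊎ (w ≡ ψ̄ a u))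
proposition6p9 k a t z _ epz img w (i , w≡slice) 1<|w| notPower conj with m≤n⇒∃[o]m+o≡n 1<|w|
... | W₂ , |w|≡ = Decomposition.decompose a t z epz img i (suc W₂) w w≡ (s≤s z≤n) conj notPower
  where
    w≡ : w ≡ seg z i (suc (suc W₂))
    w≡ = trans w≡slice (trans (cong (slice z i) (sym |w|≡)) (slice-seg z i _))
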